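{- Let $D$ be an eulerian digraph in which every vertex has degree congruent to $2$ mod $4$, and let $T$ be any directed euler circuit of $D$. Then $D$ has a bi-eulerian directed embedding (which is necessarily orientable) with one of its two faces bounded by $T$.
   Context: Digraphs are finite and may have loops and multiple arcs; the degree of a vertex is its total degree (indegree plus outdegree). A digraph is eulerian if it has a directed circuit using every arc and every vertex (a directed euler circuit). Embeddings are cellular embeddings in closed surfaces. A directed embedding is an embedding in which every face is bounded by a directed closed walk. A bi-eulerian embedding of a digraph is an embedding with exactly two faces, each bounded by a directed euler circuit. -}

module Defs where

open import Data.Nat using (ℕ; zero; suc; _+_; _*_; NonZero)
open import Data.Nat.DivMod using (_mod_; _%_)
open import Data.Fin using (Fin; _≟_)
open import Data.Bool using (Bool; true; false; not; if_then_else_)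
open import Data.List using (List; map)
open import Data.Nat.ListAction using (sum)
open import Data.List using () renaming (allFin to allFinL)
open import Data.Product using (Σ; ∃; _×_; _,_; proj₁; proj₂)
open import Data.Sum using (_⊎_)
open import Relation.Nullary using (¬_; does)
open import Relation.Binary.PropositionalEquality using (_≡_)

record Digraph : Set where
  field
    nV nA : ℕ
    tail head : Fin nA → Fin nV
open Digraph public

iter : {A : Set} → (A → A) → ℕ → A → A
iter f zero x = x
iter f (suc n) x = f (iter f n x)

ind : {n : ℕ} → Fin n → Fin n → ℕ
ind a b = if does (a ≟ b) then 1 else 0

-- total degree = outdegree + indegree (a loop contributes 2)
degree : (D : Digraph) → Fin (nV D) → ℕ
degree D v = sum (map (λ e → ind (tail D e) v + ind (head D e) v) (allFinL (nA D)))

record EulerCircuit (D : Digraph) : Set where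
  field
    len     : ℕ
    lenOK   : nA D ≡ suc len
    walk    : Fin (suc len) → Fin (nA D)
    closed  : ∀ (i : ℕ) → head D (walk (i mod suc len)) ≡ tail D (walk (suc i mod suc len))
    injW    : ∀ i j → walk i ≡ walk j → i ≡ j
    surjW   : ∀ e → ∃ λ i → walk i ≡ e
    covers  : ∀ v → ∃ λ i → tail D (walk i) ≡ v
open EulerCircuit public

Eulerian : Digraph → Set
Eulerian D = EulerCircuit D

-- Darts (arc-ends): (e , false) is the tail end of e, (e , true) the head end.
Dart : Digraph → Set
Dart D = Fin (nA D) × Bool

dartVertex : (D : Digraph) → Dart D → Fin (nV D)
dartVertex D (e , false) = tail D e
dartVertex D (e , true)  = head D e

θ : (D : Digraph) → Dart D → Dart D
θ D (e , b) = (e , not b)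

-- Cellular embedding in a closed orientable surface, given combinatorially by a
-- rotation system: a permutation ρ of the darts whose cycles are exactly the
-- sets of darts at each vertex (the local cyclic order around each vertex).
record Rotation (D : Digraph) : Set where
  field
    ρ      : Dart D → Dart D
    ρ⁻¹    : Dart D → Dart D
    invˡ   : ∀ d → ρ⁻¹ (ρ d) ≡ d
    invʳ   : ∀ d → ρ (ρ⁻¹ d) ≡ d
    local  : ∀ d → dartVertex D (ρ d) ≡ dartVertex D d
    cyclic : ∀ d d' → dartVertex D d ≡ dartVertex D d' → ∃ λ j → iter ρ j d ≡ d'
open Rotation public

-- Face-tracing permutation: from dart d traverse its arc to the other end,
-- then turn to the next dart in the rotation there.  Faces = orbits of φ.
φ : {D : Digraph} → Rotation D → Dart D → Dart D
φ {D} R d = ρ R (θ D d)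

SameFace : {D : Digraph} → Rotation D → Dart D → Dart D → Set
SameFace R d d' = ∃ λ j → iter (φ R) j d ≡ d'

-- Starting at dart d, the face either
-- traverses the arcs T_0, T_1, ... forwards (darts at tails), or traverses
-- T_0, T_{-1}, T_{-2}, ... backwards (darts at heads).
FaceBoundedBy : {D : Digraph} → Rotation D → Dart D → EulerCircuit D → Set
FaceBoundedBy R d T =
    (∀ (i : ℕ) → iter (φ R) i d ≡ (walk T (i mod suc (len T)) , false))
  ⊎ (∀ (i : ℕ) → iter (φ R) i d ≡ (walk T ((i * len T) mod suc (len T)) , true))

BiEulerian : {D : Digraph} → Rotation D → Set
BiEulerian {D} R =
  Σ (Dart D) λ d₁ → Σ (Dart D) λ d₂ →
  Σ (EulerCircuit D) λ T₁ → Σ (EulerCircuit D) λ T₂ →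
    FaceBoundedBy R d₁ T₁ × FaceBoundedBy R d₂ T₂
    × ¬ SameFace R d₁ d₂
    × (∀ d → SameFace R d₁ d ⊎ SameFace R d₂ d)

{-# OPTIONS --safe #-}
-- Number the arcs of T by Fin m in the order T traverses them, let σ i = i + 1 (mod m), and put i
-- in the class of the vertex where arc i ends (= where arc σ i starts).  If the rotation sends the
-- head-end of arc i to the tail-end of arc σ i, then T bounds a face; the rest of the rotation is a
-- permutation ψ (tail-end of arc i ↦ head-end of arc ψ i), the other face is the orbit of ψ, and the
-- rotation at a vertex is a single cycle iff ψ ∘ σ is transitive on its class.  So we need an
-- m-cycle ψ such that ψ ∘ σ preserves every class and is transitive on it.
--
-- Start from ψ = σ⁻¹, i.e. ψ ∘ σ = id.  As deg v = 2 |class v| ≡ 2 (mod 4), every class has odd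
-- size: fix a root r in each class and split its other points into pairs (x , y).  Multiplying ψ on
-- the left by the 3-cycle (r x y) or (r y x) inserts x and y into the cycle of r under ψ ∘ σ, and as
-- r, x, y lie on the single cycle of ψ, one of the two orientations keeps ψ an m-cycle.
module Submission where

open import Defs
open import Algebra.Properties.CommutativeSemigroup using (interchange)
open import Data.Bool using (true; false; if_then_else_)
open import Data.Empty using (⊥-elim)
open import Data.Fin using (Fin; zero; toℕ; fromℕ<)
open import Data.Fin.Properties using (toℕ-injective; toℕ<n; toℕ-fromℕ<; injective⇒≤)
open import Data.List as List using (List; []; _∷_; _++_; length; filter; concatMap; allFin)
open import Data.List.Properties using (map-∘; map-cong)
open import Data.List.Membership.Propositional using (_∈_; _∉_)
open import Data.List.Membership.Propositional.Properties
  using (∈-allFin; ∈-filter⁺; ∈-filter⁻; ∈-concatMap⁻; ∈-concat⁺′; ∈-map⁺)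
open import Data.List.Membership.Propositional.Properties.WithK using (unique∧set⇒bag)
open import Data.List.Relation.Binary.BagAndSetEquality using (∼bag⇒↭)
open import Data.List.Relation.Binary.Disjoint.Propositional using (Disjoint)
open import Data.List.Relation.Binary.Permutation.Propositional using (_↭_; ↭-refl; ↭-sym; ↭-swap)
import Data.List.Relation.Binary.Permutation.Propositional.Properties as ↭
open import Data.List.Relation.Unary.All as All using (All; _∷_)
import Data.List.Relation.Unary.All.Properties as All
open import Data.List.Relation.Unary.AllPairs as AllPairs using (_∷_)
import Data.List.Relation.Unary.AllPairs.Properties as AllPairs
open import Data.List.Relation.Unary.Any using (here; there; satisfied)
open import Data.List.Relation.Unary.Unique.Propositional using (Unique)
open import Data.List.Relation.Unary.Unique.Propositional.Properties as Unique
  using (allFin⁺; drop⁺; filter⁺; concat⁺; Unique[x∷xs]⇒x∉xs)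
open import Data.Nat
  using (ℕ; zero; suc; _+_; _*_; _∸_; _<_; _≤_; _<?_; z≤n; s≤s; z<s; s<s⁻¹; s≤s⁻¹; NonZero; _≤′_; ≤′-refl; ≤′-step)
open import Data.Nat.DivMod
  using (_%_; _/_; _mod_; m≡m%n+[m/n]*n; m%n<n; m%n%n≡m%n; %-distribˡ-+; n%n≡0; m<n⇒m%n≡m; m*n%n≡0)
open import Data.Nat.ListAction using (sum)
open import Data.Nat.ListAction.Properties using (sum-↭)
open import Data.Nat.Properties
open import Data.Product using (Σ; ∃; ∃₂; _×_; _,_; proj₁; proj₂; map)
open import Data.Sum using (_⊎_; inj₁; inj₂; [_,_]′)
open import Function using (_∘_; id; mk⇔)
open import Function.Definitions using (Injective)
open import Relation.Binary.Definitions using (DecidableEquality; tri<; tri≈; tri>)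
open import Relation.Binary.PropositionalEquality
open import Relation.Nullary using (¬_; Dec; yes; no; does)
open import Relation.Nullary.Decidable using (dec-true; dec-false)

-- Iteration and orbits

module _ {A : Set} (f : A → A) where

  iter-+ : ∀ i j x → iter f (i + j) x ≡ iter f i (iter f j x)
  iter-+ zero    j x = refl
  iter-+ (suc i) j x = cong f (iter-+ i j x)

  iter-sucʳ : ∀ n x → iter f (suc n) x ≡ iter f n (f x)
  iter-sucʳ zero    x = refl
  iter-sucʳ (suc n) x = cong f (iter-sucʳ n x)

  iter-fixed : ∀ {x} → f x ≡ x → ∀ n → iter f n x ≡ x
  iter-fixed fx zero    = refl
  iter-fixed fx (suc n) = trans (cong f (iter-fixed fx n)) fx

  iter-inverse : ∀ {n} → (∀ z → iter f (suc n) z ≡ z) → ∀ z → iter f n (f z) ≡ z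
  iter-inverse {n} period z = trans (sym (iter-sucʳ n z)) (period z)

  iter-* : ∀ {n x} → iter f n x ≡ x → ∀ q → iter f (q * n) x ≡ x
  iter-* fn zero    = refl
  iter-* {n} {x} fn (suc q) = begin
    iter f (n + q * n) x      ≡⟨ iter-+ n (q * n) x ⟩
    iter f n (iter f (q * n) x) ≡⟨ cong (iter f n) (iter-* fn q) ⟩
    iter f n x                ≡⟨ fn ⟩
    x                         ∎
    where open ≡-Reasoning

  iter-% : ∀ {n x} .{{_ : NonZero n}} → iter f n x ≡ x → ∀ k → iter f k x ≡ iter f (k % n) x
  iter-% {n} {x} fn k = begin
    iter f k x                                   ≡⟨ cong (λ j → iter f j x) (m≡m%n+[m/n]*n k n) ⟩
    iter f (k % n + (k / n) * n) x               ≡⟨ iter-+ (k % n) _ x ⟩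
    iter f (k % n) (iter f ((k / n) * n) x)      ≡⟨ cong (iter f (k % n)) (iter-* fn (k / n)) ⟩
    iter f (k % n) x                             ∎
    where open ≡-Reasoning

  Reach : A → A → Set
  Reach u v = ∃ λ k → iter f k u ≡ v

  Reach⁺ : A → A → Set
  Reach⁺ u v = ∃ λ k → iter f (suc k) u ≡ v

  Cyclic : Set
  Cyclic = ∀ u v → Reach u v

  OnCycle : A → A → Set
  OnCycle r z = Reach r z × Reach⁺ z r

module _ {A : Set} {f : A → A} where

  infixr 5 _⨾_ _⨾⁺_

  _⨾_ : ∀ {u v w} → Reach f u v → Reach f v w → Reach f u w
  _⨾_ {u} (i , u→v) (j , v→w) = j + i , trans (iter-+ f j i u) (trans (cong (iter f j) u→v) v→w)

  _⨾⁺_ : ∀ {u v w} → Reach f u v → Reach⁺ f v w → Reach⁺ f u w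
  _⨾⁺_ {u} (i , u→v) (j , v→w) =
    j + i , trans (iter-+ f (suc j) i u) (trans (cong (iter f (suc j)) u→v) v→w)

  Reach⁺⇒Reach : ∀ {u v} → Reach⁺ f u v → Reach f u v
  Reach⁺⇒Reach (k , u→v) = suc k , u→v

  Reach-step : ∀ {u v} → Reach f u v → Reach f u (f v)
  Reach-step (k , u→v) = suc k , cong f u→v

  iter-agree : ∀ {g u} → (∀ l → g (iter f l u) ≡ f (iter f l u)) → ∀ k → iter g k u ≡ iter f k u
  iter-agree agree zero    = refl
  iter-agree {g} agree (suc k) = trans (cong g (iter-agree agree k)) (agree k)

  Reach-resp-≗ : ∀ {g} → (∀ x → g x ≡ f x) → ∀ {u v} → Reach f u v → Reach g u v
  Reach-resp-≗ g≗f (k , u→v) = k , trans (iter-agree (λ _ → g≗f _) k) u→v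

  cyclic⇒returns : Cyclic f → ∀ a → Reach⁺ f a a
  cyclic⇒returns cyc a = let k , fa→a = cyc (f a) a in k , trans (iter-sucʳ f k a) fa→a

  hub⇒cyclic : ∀ a → (∀ z → Reach f a z × Reach f z a) → Cyclic f
  hub⇒cyclic a hub u v = proj₂ (hub u) ⨾ proj₁ (hub v)

  cyclic-inverse : ∀ {g} → (∀ x → g (f x) ≡ x) → Cyclic f → Cyclic g
  cyclic-inverse {g} g∘f cyc u v = let k , v→u = cyc v u in k , trans (cong (iter g k) (sym v→u)) (undo k v)
    where
      undo : ∀ k x → iter g k (iter f k x) ≡ x
      undo zero    x = refl
      undo (suc k) x = trans (iter-sucʳ g k _) (trans (cong (iter g k) (g∘f _)) (undo k x))

  iter-preserves : ∀ {B : Set} (κ : A → B) → (∀ x → κ (f x) ≡ κ x) → ∀ k x → κ (iter f k x) ≡ κ x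
  iter-preserves κ pres zero    x = refl
  iter-preserves κ pres (suc k) x = trans (pres _) (iter-preserves κ pres k x)

-- Minimal periods

least : {P : ℕ → Set} → (∀ n → Dec (P n)) → ∀ {k} → P k → ∃ λ n → P n × (∀ {l} → l < n → ¬ P l)
least P? {zero} p = 0 , p , λ ()
least {P} P? {suc k} p with P? 0
... | yes p₀ = 0 , p₀ , λ ()
... | no ¬p₀ =
  let n , pn , below = least {P ∘ suc} (P? ∘ suc) p
  in suc n , pn , λ { {zero} _ → ¬p₀ ; {suc l} l<n → below (s<s⁻¹ l<n) }

record MinimalPeriod {A : Set} (f : A → A) (a : A) : Set where
  field
    period-1 : ℕ

  period : ℕ
  period = suc period-1

  field
    returns : iter f period a ≡ a
    minimal : ∀ {l} → 0 < l → l < period → iter f l a ≢ a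

module _ {A : Set} (_≟_ : DecidableEquality A) {f : A → A} {a : A} where

  minimalPeriod : Reach⁺ f a a → MinimalPeriod f a
  minimalPeriod (k , returns) with least (λ l → iter f (suc l) a ≟ a) {k} returns
  ... | n , returns′ , below = record
    { period-1 = n
    ; returns  = returns′
    ; minimal  = λ { {suc l} _ l<n → below (s<s⁻¹ l<n) }
    }

module _ {A : Set} {f : A → A} {a : A} (P : MinimalPeriod f a) where
  open MinimalPeriod P

  private
    no-return : ∀ {i j} → i < j → j < period → iter f j a ≢ iter f i a
    no-return {i} {j} i<j j<n eq = minimal (≤-trans (m<n⇒0<n∸m j<n) (m≤m+n d i)) d+i<n (begin
      iter f (d + i) a      ≡⟨ iter-+ f d i a ⟩
      iter f d (iter f i a) ≡⟨ cong (iter f d) eq ⟨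
      iter f d (iter f j a) ≡⟨ iter-+ f d j a ⟨
      iter f (d + j) a      ≡⟨ cong (λ k → iter f k a) (m∸n+n≡m (<⇒≤ j<n)) ⟩
      iter f period a       ≡⟨ returns ⟩
      a                     ∎)
      where
        open ≡-Reasoning
        d = period ∸ j
        d+i<n : d + i < period
        d+i<n = subst (d + i <_) (m∸n+n≡m (<⇒≤ j<n)) (+-monoʳ-< d i<j)

  orbit-injective : ∀ {i j} → i < period → j < period → iter f i a ≡ iter f j a → i ≡ j
  orbit-injective {i} {j} i<n j<n eq with <-cmp i j
  ... | tri< i<j _ _ = ⊥-elim (no-return i<j j<n (sym eq))
  ... | tri≈ _ i≡j _ = i≡j
  ... | tri> _ _ j<i = ⊥-elim (no-return j<i i<n eq)

  position : ∀ {z} → Reach f a z → ∃ λ k → k < period × iter f k a ≡ z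
  position (k , a→z) = k % period , m%n<n k period , trans (sym (iter-% f returns k)) a→z

-- Multiplying a cyclic permutation by a 3-cycle

module ThreeCycles {X : Set} (_≟_ : DecidableEquality X) where

  cycle₃ : X → X → X → X → X
  cycle₃ a b c z = if does (z ≟ a) then b else if does (z ≟ b) then c else if does (z ≟ c) then a else z

  Avoids : X → X → X → X → Set
  Avoids a b c z = z ≢ a × z ≢ b × z ≢ c

  module _ {a b c : X} where

    cycle₃-a : cycle₃ a b c a ≡ b
    cycle₃-a rewrite dec-true (a ≟ a) refl = refl

    cycle₃-b : a ≢ b → cycle₃ a b c b ≡ c
    cycle₃-b a≢b rewrite dec-false (b ≟ a) (a≢b ∘ sym) | dec-true (b ≟ b) refl = refl

    cycle₃-c : a ≢ c → b ≢ c → cycle₃ a b c c ≡ a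
    cycle₃-c a≢c b≢c
      rewrite dec-false (c ≟ a) (a≢c ∘ sym) | dec-false (c ≟ b) (b≢c ∘ sym) | dec-true (c ≟ c) refl = refl

    cycle₃-fixes : ∀ {z} → Avoids a b c z → cycle₃ a b c z ≡ z
    cycle₃-fixes {z} (z≢a , z≢b , z≢c)
      rewrite dec-false (z ≟ a) z≢a | dec-false (z ≟ b) z≢b | dec-false (z ≟ c) z≢c = refl

    cycle₃-preserves : ∀ {B : Set} (κ : X → B) → κ a ≡ κ b → κ b ≡ κ c → ∀ z → κ (cycle₃ a b c z) ≡ κ z
    cycle₃-preserves κ κa≡κb κb≡κc z with z ≟ a | z ≟ b | z ≟ c
    ... | yes refl | _        | _        = sym κa≡κb
    ... | no _     | yes refl | _        = sym κb≡κc
    ... | no _     | no _     | yes refl = trans κa≡κb κb≡κc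
    ... | no _     | no _     | no _     = refl

  module _ (f : X → X) {a b c : X} where

    follow-clear : ∀ u {s k} → s ≤′ k → (∀ {l} → s < l → l ≤ k → Avoids a b c (iter f l u)) →
            Reach (cycle₃ a b c ∘ f) (iter f s u) (iter f k u)
    follow-clear u ≤′-refl clear = 0 , refl
    follow-clear u (≤′-step s≤k) clear =
      subst (Reach _ _) (cycle₃-fixes (clear (s≤s (≤′⇒≤ s≤k)) ≤-refl))
            (Reach-step (follow-clear u s≤k (λ s<l l≤k → clear s<l (m≤n⇒m≤1+n l≤k))))

    clear-arc : ∀ u {s k e} → s ≤ k → k < e → (∀ {l} → s < l → l < e → Avoids a b c (iter f l u)) →
          Reach (cycle₃ a b c ∘ f) (iter f s u) (iter f k u)
          × Reach (cycle₃ a b c ∘ f) (iter f k u) (cycle₃ a b c (iter f e u))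
    clear-arc u {e = suc e} s≤k k<e clear =
        follow-clear u (≤⇒≤′ s≤k) (λ s<l l≤k → clear s<l (≤-<-trans l≤k k<e))
      , Reach-step (follow-clear u (≤⇒≤′ (s≤s⁻¹ k<e)) (λ k<l l≤e → clear (≤-<-trans s≤k k<l) (s≤s l≤e)))

  -- With b = fᵖ a and c = f^q a, the map (a b c) ∘ f runs through the arcs [a , b), [c , a), [b , c)
  -- of the cycle of f, in this order.
  module _ {f : X → X} (cyc : Cyclic f) {a : X} (P : MinimalPeriod f a) {p q : ℕ}
           (a≢b : a ≢ iter f p a) (p<q : p < q) (q<n : q < MinimalPeriod.period P) where
    open MinimalPeriod P using (period; returns)

    private
      b c : X
      b = iter f p a
      c = iter f q a

      g : X → X
      g = cycle₃ a b c ∘ f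

      0<p : 0 < p
      0<p = n≢0⇒n>0 λ p≡0 → a≢b (cong (λ i → iter f i a) (sym p≡0))

      p<n : p < period
      p<n = <-trans p<q q<n

      distinct : ∀ {i j} → i < period → j < period → i ≢ j → iter f i a ≢ iter f j a
      distinct i<n j<n i≢j = i≢j ∘ orbit-injective P i<n j<n

      a≢c : a ≢ c
      a≢c = distinct z<s q<n (<⇒≢ (<-trans 0<p p<q))

      b≢c : b ≢ c
      b≢c = distinct p<n q<n (<⇒≢ p<q)

      avoids : ∀ {l} → 0 < l → l < period → l ≢ p → l ≢ q → Avoids a b c (iter f l a)
      avoids 0<l l<n l≢p l≢q = distinct l<n z<s (>⇒≢ 0<l) , distinct l<n p<n l≢p , distinct l<n q<n l≢q

      segment : ∀ {s k e} → s ≤ k → k < e → e ≤ period → (∀ {l} → s < l → l < e → l ≢ p × l ≢ q) →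
                Reach g (iter f s a) (iter f k a) × Reach g (iter f k a) (cycle₃ a b c (iter f e a))
      segment s≤k k<e e≤n between = clear-arc f a s≤k k<e λ s<l l<e →
        let l≢p , l≢q = between s<l l<e in avoids (≤-<-trans z≤n s<l) (<-≤-trans l<e e≤n) l≢p l≢q

      first : ∀ {k} → k < p → Reach g a (iter f k a) × Reach g (iter f k a) c
      first k<p = map id (subst (Reach g _) (cycle₃-b a≢b))
        (segment z≤n k<p (<⇒≤ p<n) λ _ l<p → <⇒≢ l<p , <⇒≢ (<-trans l<p p<q))

      second : ∀ {k} → p ≤ k → k < q → Reach g b (iter f k a) × Reach g (iter f k a) a
      second p≤k k<q = map id (subst (Reach g _) (cycle₃-c a≢c b≢c))
        (segment p≤k k<q (<⇒≤ q<n) λ p<l l<q → >⇒≢ p<l , <⇒≢ l<q)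

      third : ∀ {k} → q ≤ k → k < period → Reach g c (iter f k a) × Reach g (iter f k a) b
      third q≤k k<n = map id (subst (Reach g _) (trans (cong (cycle₃ a b c) returns) cycle₃-a))
        (segment q≤k k<n ≤-refl λ q<l _ → >⇒≢ (<-trans p<q q<l) , >⇒≢ q<l)

      a⇝c : Reach g a c
      a⇝c = proj₂ (first 0<p)

      b⇝a : Reach g b a
      b⇝a = proj₂ (second ≤-refl p<q)

      c⇝b : Reach g c b
      c⇝b = proj₂ (third ≤-refl q<n)

      through-a : ∀ z → Reach g a z × Reach g z a
      through-a z with position P (cyc a z)
      ... | k , k<n , refl with k <? p | k <? q
      ... | yes k<p | _       = let a⇝z , z⇝c = first k<p in a⇝z , z⇝c ⨾ c⇝b ⨾ b⇝a
      ... | no k≮p  | yes k<q = let b⇝z , z⇝a = second (≮⇒≥ k≮p) k<q in a⇝c ⨾ c⇝b ⨾ b⇝z , z⇝a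
      ... | no _    | no k≮q  = let c⇝z , z⇝b = third (≮⇒≥ k≮q) k<n in a⇝c ⨾ c⇝z , z⇝b ⨾ b⇝a

    cyclic-cycle₃-ordered : Cyclic (cycle₃ a (iter f p a) (iter f q a) ∘ f)
    cyclic-cycle₃-ordered = hub⇒cyclic a through-a

  cyclic-cycle₃ : ∀ {f} → Cyclic f → ∀ {a b c} → a ≢ b → a ≢ c → b ≢ c →
                  Cyclic (cycle₃ a b c ∘ f) ⊎ Cyclic (cycle₃ a c b ∘ f)
  cyclic-cycle₃ {f} cyc {a} {b} {c} a≢b a≢c b≢c with minimalPeriod _≟_ (cyclic⇒returns cyc a)
  ... | P with position P (cyc a b) | position P (cyc a c)
  ... | p , p<n , refl | q , q<n , refl with <-cmp p q
  ... | tri< p<q _ _ = inj₁ (cyclic-cycle₃-ordered cyc P a≢b p<q q<n)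
  ... | tri≈ _ refl _ = ⊥-elim (b≢c refl)
  ... | tri> _ _ q<p = inj₂ (cyclic-cycle₃-ordered cyc P a≢c q<p p<n)

  -- (r x y) ∘ t inserts the fixed points x and y into the cycle of t through r, just before r.
  module _ {t : X → X} {r x y : X} (x≢y : x ≢ y) (r≢x : r ≢ x) (r≢y : r ≢ y)
           (tx≡x : t x ≡ x) (ty≡y : t y ≡ y) (P : MinimalPeriod t r) where
    open MinimalPeriod P

    private
      g : X → X
      g = cycle₃ r x y ∘ t

      misses-fixed : ∀ {w l} → t w ≡ w → r ≢ w → l < period → iter t l r ≢ w
      misses-fixed {w} {l} tw≡w r≢w l<n tˡr≡w = r≢w (begin
        r                              ≡⟨ returns ⟨
        iter t period r                ≡⟨ cong (λ k → iter t k r) (m∸n+n≡m (<⇒≤ l<n)) ⟨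
        iter t (period ∸ l + l) r      ≡⟨ iter-+ t (period ∸ l) l r ⟩
        iter t (period ∸ l) (iter t l r) ≡⟨ cong (iter t (period ∸ l)) tˡr≡w ⟩
        iter t (period ∸ l) w          ≡⟨ iter-fixed t tw≡w (period ∸ l) ⟩
        w                              ∎)
        where open ≡-Reasoning

      via-x : ∀ {k} → k < period → Reach g r (iter t k r) × Reach g (iter t k r) x
      via-x k<n = map id (subst (Reach g _) (trans (cong (cycle₃ r x y) returns) cycle₃-a))
        (clear-arc t r z≤n k<n λ 0<l l<n →
          minimal 0<l l<n , misses-fixed tx≡x r≢x l<n , misses-fixed ty≡y r≢y l<n)

      gx≡y : g x ≡ y
      gx≡y = trans (cong (cycle₃ r x y) tx≡x) (cycle₃-b r≢x)

      gy≡r : g y ≡ r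
      gy≡r = trans (cong (cycle₃ r x y) ty≡y) (cycle₃-c r≢y x≢y)

      r⇝x : Reach g r x
      r⇝x = proj₂ (via-x z<s)

      x⇝⁺r : Reach⁺ g x r
      x⇝⁺r = 1 , trans (cong g gx≡y) gy≡r

    merge-fixed-points : ∀ {z} → z ≡ x ⊎ z ≡ y ⊎ Reach t r z → OnCycle (cycle₃ r x y ∘ t) r z
    merge-fixed-points (inj₁ refl)        = r⇝x , x⇝⁺r
    merge-fixed-points (inj₂ (inj₁ refl)) = subst (Reach g r) gx≡y (Reach-step r⇝x) , (0 , gy≡r)
    merge-fixed-points (inj₂ (inj₂ r⇝z)) with position P r⇝z
    ... | k , k<n , refl = let r⇝z , z⇝x = via-x k<n in r⇝z , z⇝x ⨾⁺ x⇝⁺r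

-- Making a permutation transitive on classes of odd size

module _ {A : Set} where

  unpair : List (A × A) → List A
  unpair []             = []
  unpair ((x , y) ∷ ps) = x ∷ y ∷ unpair ps

  Even Odd : List A → Set
  Even xs = ∃ λ ps → xs ≡ unpair ps
  Odd  xs = ∃₂ λ r ps → xs ≡ r ∷ unpair ps

  even-or-odd : ∀ xs → Even xs ⊎ Odd xs
  even-or-odd []       = inj₁ ([] , refl)
  even-or-odd (x ∷ xs) with even-or-odd xs
  ... | inj₁ (ps , refl)     = inj₂ (x , ps , refl)
  ... | inj₂ (y , ps , refl) = inj₁ ((x , y) ∷ ps , refl)

  length-unpair : ∀ ps → length (unpair ps) ≡ 2 * length ps
  length-unpair []       = refl
  length-unpair (_ ∷ ps) = trans (cong (2 +_) (length-unpair ps)) (sym (*-suc 2 (length ps)))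

  ∈-unpair : ∀ {x y ps} → (x , y) ∈ ps → x ∈ unpair ps × y ∈ unpair ps
  ∈-unpair {ps = _ ∷ _} (here refl) = here refl , there (here refl)
  ∈-unpair {ps = _ ∷ _} (there m)   = map (there ∘ there) (there ∘ there) (∈-unpair m)

  unpair-++ : ∀ ps qs → unpair (ps ++ qs) ≡ unpair ps ++ unpair qs
  unpair-++ []             qs = refl
  unpair-++ ((x , y) ∷ ps) qs = cong (λ zs → x ∷ y ∷ zs) (unpair-++ ps qs)

  unpair-concatMap : ∀ {B : Set} (h : B → List (A × A)) vs → unpair (concatMap h vs) ≡ concatMap (unpair ∘ h) vs
  unpair-concatMap h []       = refl
  unpair-concatMap h (v ∷ vs) = trans (unpair-++ (h v) _) (cong (unpair (h v) ++_) (unpair-concatMap h vs))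

module ClassCycles {X V : Set} (_≟_ : DecidableEquality X) (_≟ᵛ_ : DecidableEquality V)
                   (cl : X → V) (f : X → X) (root : V → X) (cl-root : ∀ v → cl (root v) ≡ v) where
  open ThreeCycles _≟_

  record Invariant (t : X → X) (pending : List X) : Set where
    field
      composite-cyclic  : Cyclic (t ∘ f)
      preserves-class   : ∀ z → cl (t z) ≡ cl z
      fixes-pending     : ∀ {z} → z ∈ pending → t z ≡ z
      on-root-cycle     : ∀ {z} → z ∉ pending → OnCycle t (root (cl z)) z
      pending-unique    : Unique pending
      roots-not-pending : ∀ v → root v ∉ pending

  initial : Cyclic f → ∀ {pending} → Unique pending → (∀ v → root v ∉ pending) →
            (∀ {z} → z ∉ pending → z ≡ root (cl z)) → Invariant id pending
  initial cyc unique roots covered = record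
    { composite-cyclic  = cyc
    ; preserves-class   = λ _ → refl
    ; fixes-pending     = λ _ → refl
    ; on-root-cycle     = λ z∉ → (0 , sym (covered z∉)) , (0 , covered z∉)
    ; pending-unique    = unique
    ; roots-not-pending = roots
    }

  private
    ∉-cons₂ : ∀ {z x y : X} {ps} → z ≢ x → z ≢ y → z ∉ ps → z ∉ x ∷ y ∷ ps
    ∉-cons₂ z≢x _   _    (here z≡x)           = z≢x z≡x
    ∉-cons₂ _   z≢y _    (there (here z≡y))   = z≢y z≡y
    ∉-cons₂ _   _   z∉ps (there (there z∈ps)) = z∉ps z∈ps

    unique-cons₂ : ∀ {x y : X} {ps} → Unique (x ∷ y ∷ ps) → x ≢ y × x ∉ ps × y ∉ ps
    unique-cons₂ ((x≢y ∷ x∉ps) ∷ y∉ps ∷ _) = x≢y , All.All¬⇒¬Any x∉ps , All.All¬⇒¬Any y∉ps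

  Invariant-swap : ∀ {t x y ps} → Invariant t (x ∷ y ∷ ps) → Invariant t (y ∷ x ∷ ps)
  Invariant-swap {t} inv = record
    { composite-cyclic  = composite-cyclic
    ; preserves-class   = preserves-class
    ; fixes-pending     = fixes-pending ∘ swap
    ; on-root-cycle     = λ z∉ → on-root-cycle (z∉ ∘ swap)
    ; pending-unique    = unique-swap pending-unique
    ; roots-not-pending = λ v → roots-not-pending v ∘ swap
    }
    where
      open Invariant inv
      swap : ∀ {z a b zs} → z ∈ a ∷ b ∷ zs → z ∈ b ∷ a ∷ zs
      swap = ↭.∈-resp-↭ (↭-swap _ _ ↭-refl)
      unique-swap : ∀ {a b zs} → Unique (a ∷ b ∷ zs) → Unique (b ∷ a ∷ zs)
      unique-swap ((a≢b ∷ a∉zs) ∷ b∉zs ∷ u) = (≢-sym a≢b ∷ b∉zs) ∷ a∉zs ∷ u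

  module Absorb {t x y ps} (inv : Invariant t (x ∷ y ∷ ps)) {v} (x∈v : cl x ≡ v) (y∈v : cl y ≡ v) where
    open Invariant inv

    x≢y : x ≢ y
    x≢y = proj₁ (unique-cons₂ pending-unique)

    r≢x : root v ≢ x
    r≢x = roots-not-pending v ∘ here

    r≢y : root v ≢ y
    r≢y = roots-not-pending v ∘ there ∘ here

    private
      r : X
      r = root v

      x∉ps : x ∉ ps
      x∉ps = proj₁ (proj₂ (unique-cons₂ pending-unique))

      y∉ps : y ∉ ps
      y∉ps = proj₂ (proj₂ (unique-cons₂ pending-unique))

      t′ : X → X
      t′ = cycle₃ r x y ∘ t

      r-returns : Reach⁺ t r r
      r-returns = proj₂ (subst (λ w → OnCycle t (root w) r) (cl-root v) (on-root-cycle (roots-not-pending v)))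

      merge-into-r : ∀ {z} → z ≡ x ⊎ z ≡ y ⊎ Reach t r z → OnCycle t′ r z
      merge-into-r = merge-fixed-points x≢y r≢x r≢y (fixes-pending (here refl))
                       (fixes-pending (there (here refl))) (minimalPeriod _≟_ r-returns)

      located : ∀ {z} → cl z ≡ v → z ∉ ps → z ≡ x ⊎ z ≡ y ⊎ Reach t r z
      located {z} z∈v z∉ps with z ≟ x | z ≟ y
      ... | yes z≡x | _       = inj₁ z≡x
      ... | no _    | yes z≡y = inj₂ (inj₁ z≡y)
      ... | no z≢x  | no z≢y  = inj₂ (inj₂
        (subst (λ w → Reach t (root w) z) z∈v (proj₁ (on-root-cycle (∉-cons₂ z≢x z≢y z∉ps)))))

      outside : ∀ {w} → cl w ≢ v → Avoids r x y w
      outside w∉v = (λ w≡r → w∉v (trans (cong cl w≡r) (cl-root v)))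
                  , (λ w≡x → w∉v (trans (cong cl w≡x) x∈v))
                  , (λ w≡y → w∉v (trans (cong cl w≡y) y∈v))

      agrees-outside : ∀ {w} → cl w ≢ v → ∀ l → t′ (iter t l w) ≡ t (iter t l w)
      agrees-outside {w} w∉v l = cycle₃-fixes (outside λ tᶫw∈v →
        w∉v (trans (sym (trans (preserves-class _) (iter-preserves cl preserves-class l w))) tᶫw∈v))

      transfer : ∀ {z} → cl z ≢ v → OnCycle t (root (cl z)) z → OnCycle t′ (root (cl z)) z
      transfer {z} z∉v ((i , rᶻ⇝z) , (j , z⇝rᶻ)) =
          (i , trans (iter-agree {f = t} {g = t′} (agrees-outside (z∉v ∘ trans (sym (cl-root (cl z))))) i) rᶻ⇝z)
        , (j , trans (iter-agree {f = t} {g = t′} (agrees-outside z∉v) (suc j)) z⇝rᶻ)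

      on-root-cycle′ : ∀ {z} → z ∉ ps → OnCycle t′ (root (cl z)) z
      on-root-cycle′ {z} z∉ps with cl z ≟ᵛ v
      ... | yes z∈v = subst (λ w → OnCycle t′ (root w) z) (sym z∈v) (merge-into-r (located z∈v z∉ps))
      ... | no z∉v  = transfer z∉v (on-root-cycle (∉-cons₂ (λ z≡x → z∉v (trans (cong cl z≡x) x∈v))
                                                          (λ z≡y → z∉v (trans (cong cl z≡y) y∈v)) z∉ps))

      fixes-pending′ : ∀ {z} → z ∈ ps → t′ z ≡ z
      fixes-pending′ {z} z∈ps = trans (cong (cycle₃ r x y) (fixes-pending (there (there z∈ps))))
        (cycle₃-fixes ( (λ z≡r → roots-not-pending v (there (there (subst (_∈ ps) z≡r z∈ps))))
                      , (λ z≡x → x∉ps (subst (_∈ ps) z≡x z∈ps))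
                      , (λ z≡y → y∉ps (subst (_∈ ps) z≡y z∈ps))))

    absorb : Cyclic (cycle₃ (root v) x y ∘ t ∘ f) → Invariant (cycle₃ (root v) x y ∘ t) ps
    absorb cyc = record
      { composite-cyclic  = cyc
      ; preserves-class   = λ z →
          trans (cycle₃-preserves cl (trans (cl-root v) (sym x∈v)) (trans x∈v (sym y∈v)) (t z)) (preserves-class z)
      ; fixes-pending     = fixes-pending′
      ; on-root-cycle     = on-root-cycle′
      ; pending-unique    = drop⁺ 2 pending-unique
      ; roots-not-pending = λ w → roots-not-pending w ∘ there ∘ there
      }

  step : ∀ {t x y ps} → Invariant t (x ∷ y ∷ ps) → cl x ≡ cl y → ∃ λ t′ → Invariant t′ ps
  step inv x~y = [ (λ c → _ , absorb c) , (λ c → _ , Absorb.absorb (Invariant-swap inv) (sym x~y) refl c) ]′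
                 (cyclic-cycle₃ (Invariant.composite-cyclic inv) r≢x r≢y x≢y)
    where open Absorb inv refl (sym x~y)

  run : ∀ R {t} → All (λ (x , y) → cl x ≡ cl y) R → Invariant t (unpair R) → ∃ λ t′ → Invariant t′ []
  run []            _            inv = _ , inv
  run ((x , y) ∷ R) (x~y ∷ same) inv = run R same (proj₂ (step inv x~y))

  class-transitive : ∀ {t} → Invariant t [] → ∀ {z z′} → cl z ≡ cl z′ → Reach t z z′
  class-transitive {t} inv {z} {z′} z~z′ =
    let _ , z⇝⁺r = on-root-cycle {z} (λ ())
        r′⇝z′ , _ = on-root-cycle {z′} (λ ())
    in Reach⁺⇒Reach z⇝⁺r ⨾ subst (λ w → Reach t (root w) z′) (sym z~z′) r′⇝z′
    where open Invariant inv

module ClassPartition {X V : Set} (_≟_ : DecidableEquality X) (_≟ᵛ_ : DecidableEquality V) (cl : X → V)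
                      {xs : List X} (xs-unique : Unique xs) (xs-complete : ∀ z → z ∈ xs)
                      {vs : List V} (vs-unique : Unique vs) (vs-complete : ∀ v → v ∈ vs) where

  class : V → List X
  class v = filter (λ z → cl z ≟ᵛ v) xs

  private
    ∈-class⁻ : ∀ {z v} → z ∈ class v → cl z ≡ v
    ∈-class⁻ = proj₂ ∘ ∈-filter⁻ (λ z → cl z ≟ᵛ _) {xs = xs}

  module _ (odd : ∀ v → Odd (class v)) where

    private
      root : V → X
      root v = proj₁ (odd v)

      pairs : V → List (X × X)
      pairs v = proj₁ (proj₂ (odd v))

      class≡ : ∀ v → class v ≡ root v ∷ unpair (pairs v)
      class≡ v = proj₂ (proj₂ (odd v))

      all-pairs : List (X × X)
      all-pairs = concatMap pairs vs

      pending : List X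
      pending = unpair all-pairs

      pending≡ : pending ≡ concatMap (unpair ∘ pairs) vs
      pending≡ = unpair-concatMap pairs vs

      paired⇒∈class : ∀ {z v} → z ∈ unpair (pairs v) → z ∈ class v
      paired⇒∈class {v = v} m = subst (_ ∈_) (sym (class≡ v)) (there m)

      pending⁻ : ∀ {z} → z ∈ pending → ∃ λ v → z ∈ unpair (pairs v)
      pending⁻ m = satisfied (∈-concatMap⁻ (unpair ∘ pairs) {xs = vs} (subst (_ ∈_) pending≡ m))

      pending⁺ : ∀ {z v} → z ∈ unpair (pairs v) → z ∈ pending
      pending⁺ {v = v} m = subst (_ ∈_) (sym pending≡) (∈-concat⁺′ m (∈-map⁺ (unpair ∘ pairs) (vs-complete v)))

      class-unique : ∀ v → Unique (root v ∷ unpair (pairs v))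
      class-unique v = subst Unique (class≡ v) (filter⁺ (λ z → cl z ≟ᵛ v) xs-unique)

      cl-root : ∀ v → cl (root v) ≡ v
      cl-root v = ∈-class⁻ (subst (root v ∈_) (sym (class≡ v)) (here refl))

      pending-unique : Unique pending
      pending-unique = subst Unique (sym pending≡) (concat⁺
        (All.map⁺ (All.tabulate λ {v} _ → drop⁺ 1 (class-unique v)))
        (AllPairs.map⁺ (AllPairs.map disjoint vs-unique)))
        where
          disjoint : ∀ {v w} → v ≢ w → Disjoint (unpair (pairs v)) (unpair (pairs w))
          disjoint v≢w (z∈v , z∈w) =
            v≢w (trans (sym (∈-class⁻ (paired⇒∈class z∈v))) (∈-class⁻ (paired⇒∈class z∈w)))

      roots-not-pending : ∀ v → root v ∉ pending
      roots-not-pending v m with pending⁻ m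
      ... | w , r∈w with trans (sym (cl-root v)) (∈-class⁻ (paired⇒∈class r∈w))
      ... | refl = Unique[x∷xs]⇒x∉xs (class-unique v) r∈w

      covered : ∀ {z} → z ∉ pending → z ≡ root (cl z)
      covered {z} z∉ with subst (z ∈_) (class≡ (cl z)) (∈-filter⁺ (λ z → cl z ≟ᵛ _) (xs-complete z) refl)
      ... | here z≡r = z≡r
      ... | there m  = ⊥-elim (z∉ (pending⁺ m))

      same-class : All (λ (x , y) → cl x ≡ cl y) all-pairs
      same-class = All.tabulate λ m →
        let v , xy∈v = satisfied (∈-concatMap⁻ pairs {xs = vs} m)
            x∈v , y∈v = ∈-unpair xy∈v
        in trans (∈-class⁻ (paired⇒∈class x∈v)) (sym (∈-class⁻ (paired⇒∈class y∈v)))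

    class-cycles : ∀ {f} → Cyclic f →
                   ∃ λ t → Cyclic (t ∘ f) × (∀ z → cl (t z) ≡ cl z) × (∀ {z z′} → cl z ≡ cl z′ → Reach t z z′)
    class-cycles {f} cyc =
      let t , inv = run all-pairs same-class (initial cyc pending-unique roots-not-pending covered)
      in t , Invariant.composite-cyclic inv , Invariant.preserves-class inv , class-transitive inv
      where open ClassCycles _≟_ _≟ᵛ_ cl f root cl-root

-- Cyclic permutations of Fin m

module _ {m : ℕ} {f : Fin m → Fin m} (cyc : Cyclic f) (a : Fin m) where
  private
    P : MinimalPeriod f a
    P = minimalPeriod Data.Fin._≟_ (cyclic⇒returns cyc a)
    open MinimalPeriod P using (period; returns)

    as-fin : ∀ {N z} → (∃ λ k → k < N × iter f k a ≡ z) → ∃ λ (i : Fin N) → iter f (toℕ i) a ≡ z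
    as-fin (k , k<N , fᵏa≡z) = fromℕ< k<N , trans (cong (λ j → iter f j a) (toℕ-fromℕ< k<N)) fᵏa≡z

    index : Fin m → Fin period
    index z = proj₁ (as-fin (position P (cyc a z)))

    iter-index : ∀ z → iter f (toℕ (index z)) a ≡ z
    iter-index z = proj₂ (as-fin (position P (cyc a z)))

    period≡m : period ≡ m
    period≡m = ≤-antisym
      (injective⇒≤ {f = λ k → iter f (toℕ k) a} (toℕ-injective ∘ orbit-injective P (toℕ<n _) (toℕ<n _)))
      (injective⇒≤ {f = index} λ {z} {z′} eq →
        trans (sym (iter-index z)) (trans (cong (λ k → iter f (toℕ k) a) eq) (iter-index z′)))

  cyclic-iter-size : iter f m a ≡ a
  cyclic-iter-size = subst (λ n → iter f n a ≡ a) period≡m returns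

  cyclic-orbit-injective : ∀ {i j} → i < m → j < m → iter f i a ≡ iter f j a → i ≡ j
  cyclic-orbit-injective i<m j<m =
    orbit-injective P (subst (_ <_) (sym period≡m) i<m) (subst (_ <_) (sym period≡m) j<m)

  cyclic-orbit-surjective : ∀ z → ∃ λ (k : Fin m) → iter f (toℕ k) a ≡ z
  cyclic-orbit-surjective z =
    let k , k<n , fᵏa≡z = position P (cyc a z) in as-fin (k , subst (k <_) period≡m k<n , fᵏa≡z)

[m+n%d]%d≡[m+n]%d : ∀ m n d .{{_ : NonZero d}} → (m + n % d) % d ≡ (m + n) % d
[m+n%d]%d≡[m+n]%d m n d = begin
  (m + n % d) % d           ≡⟨ %-distribˡ-+ m (n % d) d ⟩
  (m % d + n % d % d) % d   ≡⟨ cong (λ k → (m % d + k) % d) (m%n%n≡m%n n d) ⟩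
  (m % d + n % d) % d       ≡⟨ %-distribˡ-+ m n d ⟨
  (m + n) % d               ∎
  where open ≡-Reasoning

module CyclicShift (n : ℕ) where
  private
    m : ℕ
    m = suc n

  toℕ-mod : ∀ k → toℕ (k mod m) ≡ k % m
  toℕ-mod k = toℕ-fromℕ< (m%n<n k m)

  mod-cong : ∀ i j → i % m ≡ j % m → i mod m ≡ j mod m
  mod-cong i j eq = toℕ-injective (trans (toℕ-mod i) (trans eq (sym (toℕ-mod j))))

  toℕ-mod-id : ∀ (i : Fin m) → toℕ i mod m ≡ i
  toℕ-mod-id i = toℕ-injective (trans (toℕ-mod (toℕ i)) (m<n⇒m%n≡m (toℕ<n i)))

  iter-mod : ∀ {A : Set} {g : A → A} → (∀ z → iter g m z ≡ z) → ∀ k z → iter g (toℕ (k mod m)) z ≡ iter g k z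
  iter-mod {g = g} period k z = trans (cong (λ j → iter g j z) (toℕ-mod k)) (sym (iter-% g (period z) k))

  σ : Fin m → Fin m
  σ i = suc (toℕ i) mod m

  σ-mod : ∀ k → σ (k mod m) ≡ suc k mod m
  σ-mod k = mod-cong (suc (toℕ (k mod m))) (suc k)
    (trans (cong (λ j → suc j % m) (toℕ-mod k)) ([m+n%d]%d≡[m+n]%d 1 k m))

  iter-σ : ∀ k → iter σ k zero ≡ k mod m
  iter-σ zero    = refl
  iter-σ (suc k) = trans (cong σ (iter-σ k)) (σ-mod k)

  σ-cyclic : Cyclic σ
  σ-cyclic = hub⇒cyclic zero λ v → (toℕ v , from-zero v) , (m ∸ toℕ v , to-zero v)
    where
      from-zero : ∀ v → iter σ (toℕ v) zero ≡ v
      from-zero v = trans (iter-σ (toℕ v)) (toℕ-mod-id v)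

      to-zero : ∀ v → iter σ (m ∸ toℕ v) v ≡ zero
      to-zero v = begin
        iter σ (m ∸ toℕ v) v                        ≡⟨ cong (iter σ (m ∸ toℕ v)) (from-zero v) ⟨
        iter σ (m ∸ toℕ v) (iter σ (toℕ v) zero)    ≡⟨ iter-+ σ (m ∸ toℕ v) (toℕ v) zero ⟨
        iter σ (m ∸ toℕ v + toℕ v) zero             ≡⟨ cong (λ k → iter σ k zero) (m∸n+n≡m (<⇒≤ (toℕ<n v))) ⟩
        iter σ m zero                               ≡⟨ iter-σ m ⟩
        m mod m                                     ≡⟨ mod-cong m 0 (n%n≡0 m) ⟩
        zero                                        ∎
        where open ≡-Reasoning

  σ⁻¹ : Fin m → Fin m
  σ⁻¹ = iter σ n

  σσ⁻¹ : ∀ i → σ (σ⁻¹ i) ≡ i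
  σσ⁻¹ = cyclic-iter-size σ-cyclic

  σ⁻¹σ : ∀ i → σ⁻¹ (σ i) ≡ i
  σ⁻¹σ = iter-inverse σ {n} σσ⁻¹

  σ-injective : Injective _≡_ _≡_ σ
  σ-injective {i} {j} σi≡σj = trans (sym (σ⁻¹σ i)) (trans (cong σ⁻¹ σi≡σj) (σ⁻¹σ j))

  σ⁻¹-cyclic : Cyclic σ⁻¹
  σ⁻¹-cyclic = cyclic-inverse σ⁻¹σ σ-cyclic

-- Degrees

sum-map-+ : ∀ {A : Set} (g h : A → ℕ) xs →
            sum (List.map (λ x → g x + h x) xs) ≡ sum (List.map g xs) + sum (List.map h xs)
sum-map-+ g h []       = refl
sum-map-+ g h (x ∷ xs) =
  trans (cong (g x + h x +_) (sum-map-+ g h xs)) (interchange +-commutativeSemigroup (g x) (h x) _ _)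

sum-ind≡length-filter : ∀ {A : Set} {n} (κ : A → Fin n) v xs →
                        sum (List.map (λ x → ind (κ x) v) xs) ≡ length (filter (λ x → κ x Data.Fin.≟ v) xs)
sum-ind≡length-filter κ v []       = refl
sum-ind≡length-filter κ v (x ∷ xs) with κ x Data.Fin.≟ v
... | yes _ = cong suc (sum-ind≡length-filter κ v xs)
... | no _  = sum-ind≡length-filter κ v xs

sum-reindex : ∀ {n k} (f : Fin n → Fin k) → Injective _≡_ _≡_ f → (∀ e → ∃ λ i → f i ≡ e) →
              ∀ (h : Fin k → ℕ) → sum (List.map h (allFin k)) ≡ sum (List.map (h ∘ f) (allFin n))
sum-reindex {n} {k} f f-injective f-surjective h =
  trans (sum-↭ (↭.map⁺ h (↭-sym f[allFin]↭allFin))) (cong sum (sym (map-∘ (allFin n))))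
  where
    f[allFin]↭allFin : List.map f (allFin n) ↭ allFin k
    f[allFin]↭allFin = ∼bag⇒↭ (unique∧set⇒bag (Unique.map⁺ f-injective (allFin⁺ n)) (allFin⁺ k) λ {e} →
      mk⇔ (λ _ → ∈-allFin e) (λ _ → let i , fi≡e = f-surjective e in subst (_∈ _) fi≡e (∈-map⁺ f (∈-allFin i))))

-- The embedding

module Circuit (D : Digraph) (T : EulerCircuit D) where
  open CyclicShift (len T) public

  m : ℕ
  m = suc (len T)

  W : Fin m → Fin (nA D)
  W = walk T

  idx : Fin (nA D) → Fin m
  idx e = proj₁ (surjW T e)

  W-idx : ∀ e → W (idx e) ≡ e
  W-idx e = proj₂ (surjW T e)

  idx-W : ∀ i → idx (W i) ≡ i
  idx-W i = injW T _ _ (W-idx (W i))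

  cl : Fin m → Fin (nV D)
  cl i = head D (W i)

  head≡tail-σ : ∀ i → head D (W i) ≡ tail D (W (σ i))
  head≡tail-σ i = subst (λ j → head D (W j) ≡ tail D (W (σ i))) (toℕ-mod-id i) (closed T (toℕ i))

  open ClassPartition Data.Fin._≟_ Data.Fin._≟_ cl (allFin⁺ m) ∈-allFin (allFin⁺ (nV D)) ∈-allFin public

  degree≡ : ∀ v → degree D v ≡ 2 * length (class v)
  degree≡ v = begin
    degree D v
      ≡⟨ sum-reindex W (injW T _ _) (surjW T) (λ e → ind (tail D e) v + ind (head D e) v) ⟩
    sum (List.map (λ i → ind (tail D (W i)) v + ind (cl i) v) (allFin m))
      ≡⟨ sum-map-+ (λ i → ind (tail D (W i)) v) (λ i → ind (cl i) v) (allFin m) ⟩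
    sum (List.map (λ i → ind (tail D (W i)) v) (allFin m)) + #heads
      ≡⟨ cong (_+ #heads) tails≡heads ⟩
    #heads + #heads
      ≡⟨ cong (λ k → k + k) (sum-ind≡length-filter cl v (allFin m)) ⟩
    length (class v) + length (class v)
      ≡⟨ cong (length (class v) +_) (+-identityʳ _) ⟨
    2 * length (class v) ∎
    where
      open ≡-Reasoning
      #heads : ℕ
      #heads = sum (List.map (λ i → ind (cl i) v) (allFin m))
      tails≡heads : sum (List.map (λ i → ind (tail D (W i)) v) (allFin m)) ≡ #heads
      tails≡heads = trans
        (sum-reindex σ σ-injective (λ i → σ⁻¹ i , σσ⁻¹ i) _)
        (cong sum (map-cong (λ i → cong (λ u → ind u v) (sym (head≡tail-σ i))) (allFin m)))

  classes-odd : (∀ v → degree D v % 4 ≡ 2) → ∀ v → Odd (class v)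
  classes-odd deg≡2 v with even-or-odd (class v)
  ... | inj₂ odd = odd
  ... | inj₁ (ps , class≡pairs) = ⊥-elim (0≢2 (begin
    0                            ≡⟨ m*n%n≡0 (length ps) 4 ⟨
    (length ps * 4) % 4          ≡⟨ cong (_% 4) (trans (*-comm (length ps) 4) (*-assoc 2 2 (length ps))) ⟩
    (2 * (2 * length ps)) % 4    ≡⟨ cong (λ k → (2 * k) % 4) (sym (length-unpair ps)) ⟩
    (2 * length (unpair ps)) % 4 ≡⟨ cong (λ xs → (2 * length xs) % 4) class≡pairs ⟨
    (2 * length (class v)) % 4   ≡⟨ cong (_% 4) (degree≡ v) ⟨
    degree D v % 4               ≡⟨ deg≡2 v ⟩
    2                            ∎))
    where
      open ≡-Reasoning
      0≢2 : 0 ≢ 2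
      0≢2 ()

  face-permutation : (∀ v → degree D v % 4 ≡ 2) →
                     ∃ λ ψ → Cyclic ψ × (∀ i → head D (W (ψ i)) ≡ tail D (W i))
                           × (∀ {i j} → cl i ≡ cl j → Reach (ψ ∘ σ) i j)
  face-permutation deg≡2 =
    let t , t∘σ⁻¹-cyclic , t-preserves , t-transitive = class-cycles (classes-odd deg≡2) σ⁻¹-cyclic
    in t ∘ σ⁻¹ , t∘σ⁻¹-cyclic
     , (λ i → trans (t-preserves (σ⁻¹ i)) (trans (head≡tail-σ (σ⁻¹ i)) (cong (tail D ∘ W) (σσ⁻¹ i))))
     , Reach-resp-≗ (λ i → cong t (σ⁻¹σ i)) ∘ t-transitive

  -- The rotation follows T at head-ends and ψ at tail-ends, so one face is T and the other is the
  -- ψ-orbit of head-ends, which traverses the circuit `reverse` backwards.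
  module FacePermutation (ψ : Fin m → Fin m) (ψ-cyclic : Cyclic ψ)
                         (ψ-tail : ∀ i → head D (W (ψ i)) ≡ tail D (W i))
                         (ψσ-transitive : ∀ {i j} → cl i ≡ cl j → Reach (ψ ∘ σ) i j) where

    private
      ψ⁻¹ : Fin m → Fin m
      ψ⁻¹ = iter ψ (len T)

      ψψ⁻¹ : ∀ i → ψ (ψ⁻¹ i) ≡ i
      ψψ⁻¹ = cyclic-iter-size ψ-cyclic

      ψ⁻¹ψ : ∀ i → ψ⁻¹ (ψ i) ≡ i
      ψ⁻¹ψ = iter-inverse ψ {len T} ψψ⁻¹

      ψ⁻¹-cyclic : Cyclic ψ⁻¹
      ψ⁻¹-cyclic = cyclic-inverse ψ⁻¹ψ ψ-cyclic

      ψ⁻¹-period : ∀ z → iter ψ⁻¹ m z ≡ z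
      ψ⁻¹-period = cyclic-iter-size ψ⁻¹-cyclic

      -- ψ⁻¹ has order m = len T + 1, so len T steps of ψ⁻¹ make one step of ψ.
      iter-ψ⁻¹-* : ∀ k z → iter ψ⁻¹ (k * len T) z ≡ iter ψ k z
      iter-ψ⁻¹-* zero    z = refl
      iter-ψ⁻¹-* (suc k) z = begin
        iter ψ⁻¹ (len T + k * len T) z          ≡⟨ iter-+ ψ⁻¹ (len T) (k * len T) z ⟩
        iter ψ⁻¹ (len T) (iter ψ⁻¹ (k * len T) z) ≡⟨ cong (iter ψ⁻¹ (len T)) (iter-ψ⁻¹-* k z) ⟩
        iter ψ⁻¹ (len T) (iter ψ k z)           ≡⟨ cong (iter ψ⁻¹ (len T)) (ψ⁻¹ψ _) ⟨
        iter ψ⁻¹ (len T) (ψ⁻¹ (iter ψ (suc k) z)) ≡⟨ iter-inverse ψ⁻¹ {len T} ψ⁻¹-period _ ⟩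
        iter ψ (suc k) z                        ∎
        where open ≡-Reasoning

      ρ′ : Dart D → Dart D
      ρ′ (e , true)  = W (σ (idx e)) , false
      ρ′ (e , false) = W (ψ (idx e)) , true

      ρ⁻¹′ : Dart D → Dart D
      ρ⁻¹′ (e , false) = W (σ⁻¹ (idx e)) , true
      ρ⁻¹′ (e , true)  = W (ψ⁻¹ (idx e)) , false

      round-trip : ∀ (g h : Fin m → Fin m) → (∀ i → h (g i) ≡ i) → ∀ e → W (h (idx (W (g (idx e))))) ≡ e
      round-trip g h hg≡id e = trans (cong (W ∘ h) (idx-W (g (idx e)))) (trans (cong W (hg≡id _)) (W-idx e))

      invˡ′ : ∀ d → ρ⁻¹′ (ρ′ d) ≡ d
      invˡ′ (e , true)  = cong (_, true) (round-trip σ σ⁻¹ σ⁻¹σ e)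
      invˡ′ (e , false) = cong (_, false) (round-trip ψ ψ⁻¹ ψ⁻¹ψ e)

      invʳ′ : ∀ d → ρ′ (ρ⁻¹′ d) ≡ d
      invʳ′ (e , false) = cong (_, false) (round-trip σ⁻¹ σ σσ⁻¹ e)
      invʳ′ (e , true)  = cong (_, true) (round-trip ψ⁻¹ ψ ψψ⁻¹ e)

      local′ : ∀ d → dartVertex D (ρ′ d) ≡ dartVertex D d
      local′ (e , true)  = trans (sym (head≡tail-σ (idx e))) (cong (head D) (W-idx e))
      local′ (e , false) = trans (ψ-tail (idx e)) (cong (tail D) (W-idx e))

      ρρ : ∀ i → ρ′ (ρ′ (W i , true)) ≡ (W (ψ (σ i)) , true)
      ρρ i = cong (λ j → W (ψ j) , true) (trans (idx-W _) (cong σ (idx-W i)))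

      around-vertex : ∀ k i → Reach ρ′ (W i , true) (W (iter (ψ ∘ σ) k i) , true)
      around-vertex zero    i = 0 , refl
      around-vertex (suc k) i = subst (Reach ρ′ _) (ρρ _) (Reach-step (Reach-step (around-vertex k i)))

      to-head : ∀ d → ∃ λ i → Reach ρ′ d (W i , true) × cl i ≡ dartVertex D d
      to-head (e , true)  = idx e , (0 , cong (_, true) (sym (W-idx e))) , cong (head D) (W-idx e)
      to-head (e , false) = ψ (idx e) , (1 , refl) , local′ (e , false)

      from-head : ∀ d → ∃ λ i → Reach ρ′ (W i , true) d × cl i ≡ dartVertex D d
      from-head (e , true)  = idx e , (0 , cong (_, true) (W-idx e)) , cong (head D) (W-idx e)
      from-head (e , false) = σ⁻¹ (idx e) , (1 , invʳ′ (e , false)) ,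
        trans (head≡tail-σ _) (trans (cong (tail D ∘ W) (σσ⁻¹ _)) (cong (tail D) (W-idx e)))

      cyclic′ : ∀ d d′ → dartVertex D d ≡ dartVertex D d′ → Reach ρ′ d d′
      cyclic′ d d′ same-vertex =
        let i , d⇝i , i∈ = to-head d
            j , j⇝d′ , j∈ = from-head d′
            k , πᵏi≡j = ψσ-transitive (trans i∈ (trans same-vertex (sym j∈)))
        in d⇝i ⨾ subst (λ x → Reach ρ′ _ (W x , true)) πᵏi≡j (around-vertex k i) ⨾ j⇝d′

    rotation : Rotation D
    rotation = record
      { ρ = ρ′ ; ρ⁻¹ = ρ⁻¹′ ; invˡ = invˡ′ ; invʳ = invʳ′ ; local = local′ ; cyclic = cyclic′ }

    private
      forward : ∀ k → iter (φ rotation) k (W zero , false) ≡ (W (iter σ k zero) , false)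
      forward zero    = refl
      forward (suc k) = trans (cong (φ rotation) (forward k)) (cong (λ i → W (σ i) , false) (idx-W _))

      backward : ∀ k → iter (φ rotation) k (W zero , true) ≡ (W (iter ψ k zero) , true)
      backward zero    = refl
      backward (suc k) = trans (cong (φ rotation) (backward k)) (cong (λ i → W (ψ i) , true) (idx-W _))

      reverse : EulerCircuit D
      reverse = record
        { len    = len T
        ; lenOK  = lenOK T
        ; walk   = λ j → W (iter ψ⁻¹ (toℕ j) zero)
        ; closed = closed′
        ; injW   = λ j j′ eq →
            toℕ-injective (cyclic-orbit-injective ψ⁻¹-cyclic zero (toℕ<n j) (toℕ<n j′) (injW T _ _ eq))
        ; surjW  = λ e →
            let j , eq = cyclic-orbit-surjective ψ⁻¹-cyclic zero (idx e) in j , trans (cong W eq) (W-idx e)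
        ; covers = covers′
        }
        where
          closed′ : ∀ k → head D (W (iter ψ⁻¹ (toℕ (k mod m)) zero))
                        ≡ tail D (W (iter ψ⁻¹ (toℕ (suc k mod m)) zero))
          closed′ k = begin
            head D (W (iter ψ⁻¹ (toℕ (k mod m)) zero))       ≡⟨ cong (head D ∘ W) (iter-mod ψ⁻¹-period k zero) ⟩
            head D (W (iter ψ⁻¹ k zero))                     ≡⟨ cong (head D ∘ W) (ψψ⁻¹ _) ⟨
            head D (W (ψ (iter ψ⁻¹ (suc k) zero)))           ≡⟨ ψ-tail _ ⟩
            tail D (W (iter ψ⁻¹ (suc k) zero))               ≡⟨ cong (tail D ∘ W) (iter-mod ψ⁻¹-period (suc k) zero) ⟨
            tail D (W (iter ψ⁻¹ (toℕ (suc k mod m)) zero))   ∎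
            where open ≡-Reasoning

          covers′ : ∀ v → ∃ λ j → tail D (W (iter ψ⁻¹ (toℕ j) zero)) ≡ v
          covers′ v = let i , tᵢ≡v = covers T v
                          j , eq = cyclic-orbit-surjective ψ⁻¹-cyclic zero i
                      in j , trans (cong (tail D ∘ W) eq) tᵢ≡v

    forward-face : FaceBoundedBy rotation (W zero , false) T
    forward-face = inj₁ λ k → trans (forward k) (cong (λ i → W i , false) (iter-σ k))

    private
      backward-face : FaceBoundedBy rotation (W zero , true) reverse
      backward-face = inj₂ λ k → trans (backward k) (cong (λ i → W i , true)
        (sym (trans (iter-mod ψ⁻¹-period (k * len T) zero) (iter-ψ⁻¹-* k zero))))

      faces-distinct : ¬ SameFace rotation (W zero , false) (W zero , true)
      faces-distinct (k , eq) with trans (sym (forward k)) eq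
      ... | ()

      faces-cover : ∀ d → SameFace rotation (W zero , false) d ⊎ SameFace rotation (W zero , true) d
      faces-cover (e , false) = inj₁ (toℕ (idx e) , trans (forward (toℕ (idx e)))
        (cong (_, false) (trans (cong W (trans (iter-σ (toℕ (idx e))) (toℕ-mod-id (idx e)))) (W-idx e))))
      faces-cover (e , true)  = let k , ψᵏ0≡i = ψ-cyclic zero (idx e)
        in inj₂ (k , trans (backward k) (cong (_, true) (trans (cong W ψᵏ0≡i) (W-idx e))))

    bi-eulerian : BiEulerian rotation
    bi-eulerian = _ , _ , T , reverse , forward-face , backward-face , faces-distinct , faces-cover

theorem4p5 : (D : Digraph) → Eulerian D
    → (∀ v → degree D v % 4 ≡ 2)
    → (T : EulerCircuit D)
    → Σ (Rotation D) λ R → BiEulerian R × Σ (Dart D) λ d → FaceBoundedBy R d T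
theorem4p5 D _ deg≡2 T =
  let ψ , ψ-cyclic , ψ-tail , ψσ-transitive = face-permutation deg≡2
      open FacePermutation ψ ψ-cyclic ψ-tail ψσ-transitive
  in rotation , bi-eulerian , (W zero , false) , forward-face
  where open Circuit D T
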